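{- Let $G=(V,E)$ be a finite simple graph and let $H=G[V-N[core(G)]]$. Then: (i) $H$ has no isolated vertices; (ii) $\alpha(H)=\alpha(G)-\xi(G)$; (iii) a set $S_H$ is a maximum stable set of $H$ if and only if there is a maximum stable set $S_G$ of $G$ with $S_H=S_G\cap V(H)$; (iv) $\xi(H)=0$; (v) $|S-core(G)|\leq|N(S)-N(core(G))|$ for every maximum stable set $S$ of $G$.
   Context: $\alpha(G)$ is the maximum size of a stable set; $\Omega(G)$ is the set of maximum stable sets; $core(G)=\bigcap\{S:S\in\Omega(G)\}$ and $\xi(G)=|core(G)|$. For $A\subseteq V$, $N(A)$ is the set of vertices adjacent to some vertex of $A$ and $N[A]=A\cup N(A)$. $G[X]$ is the subgraph induced by $X$. -}

module Defs where

open import Data.Nat using (ℕ; zero; suc; _⊔_)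
open import Data.Bool using (Bool; true; false)
open import Data.Bool.Properties using () renaming (_≟_ to _≟ᵇ_)
open import Data.Fin using (Fin)
open import Data.Fin.Subset using (Subset; _∈_; _⊆_; _∩_; _∪_; ⋂; ∣_∣; ⊤)
open import Data.Fin.Subset.Properties using (_∈?_; _⊆?_)
open import Data.Fin.Properties using (all?; any?)
open import Data.Vec using (Vec; []; _∷_; tabulate)
open import Data.List using (List; []; _∷_; map; _++_; filter; foldr)
open import Data.Product using (_×_)
open import Relation.Nullary using (Dec; does)
open import Relation.Nullary.Decidable using (_×-dec_; _→-dec_)
open import Relation.Binary.PropositionalEquality using (_≡_)
import Data.Nat as ℕ

record Graph (n : ℕ) : Set where
  field
    adj        : Fin n → Fin n → Bool
    adj-sym    : ∀ u v → adj u v ≡ adj v u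
    adj-irrefl : ∀ v → adj v v ≡ false
open Graph public

-- Throughout, a vertex set W : Subset n stands for the induced subgraph G[W];
-- the whole graph G is G[⊤].

Stable : ∀ {n} → Graph n → Subset n → Subset n → Set
Stable G W S = S ⊆ W × (∀ u v → u ∈ S → v ∈ S → adj G u v ≡ false)

stable? : ∀ {n} (G : Graph n) (W S : Subset n) → Dec (Stable G W S)
stable? G W S =
  (S ⊆? W)
  ×-dec all? (λ u → all? (λ v → (u ∈? S) →-dec ((v ∈? S) →-dec (adj G u v ≟ᵇ false))))

allSubsets : ∀ n → List (Subset n)
allSubsets zero    = [] ∷ []
allSubsets (suc n) = map (true ∷_) (allSubsets n) ++ map (false ∷_) (allSubsets n)

α : ∀ {n} → Graph n → Subset n → ℕ
α {n} G W = foldr _⊔_ 0 (map ∣_∣ (filter (stable? G W) (allSubsets n)))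

MaxStable : ∀ {n} → Graph n → Subset n → Subset n → Set
MaxStable G W S = Stable G W S × ∣ S ∣ ≡ α G W

maxStable? : ∀ {n} (G : Graph n) (W S : Subset n) → Dec (MaxStable G W S)
maxStable? G W S = stable? G W S ×-dec (∣ S ∣ ℕ.≟ α G W)

Ω : ∀ {n} → Graph n → Subset n → List (Subset n)
Ω {n} G W = filter (maxStable? G W) (allSubsets n)

core : ∀ {n} → Graph n → Subset n → Subset n
core G W = ⋂ (Ω G W)

ξ : ∀ {n} → Graph n → Subset n → ℕ
ξ G W = ∣ core G W ∣

N : ∀ {n} → Graph n → Subset n → Subset n
N G A = tabulate (λ v → does (any? (λ u → (u ∈? A) ×-dec (adj G u v ≟ᵇ true))))

N[_] : ∀ {n} → Graph n → Subset n → Subset n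
N[ G ] A = A ∪ N G A

{-# OPTIONS --safe #-}
-- Every maximum stable set S of G contains core(G), hence misses N(core(G)), so
-- S is the disjoint union of core(G) and S ∩ H; conversely core(G) ∪ T is stable
-- for every stable set T of H. This gives (ii) and (iii), and (iv) because every
-- vertex of H is missed by some S, hence by S ∩ H. For a maximum stable set U and
-- a stable set D disjoint from U, exchanging U ∩ N(D) for D shows
-- |D| ≤ |U ∩ N(D)|. With D = {v} this gives (i). For (v), let A be stable and
-- disjoint from core(G), and let U be a maximum stable set missing some a ∈ A:
-- induction applies to A ∩ U ⊂ A, the exchange bound to A − U, and the two
-- neighbourhood parts obtained are disjoint subsets of N(A) − N(core(G)).
module Submission where

open import Defs
open import Data.Nat using (ℕ; suc; _≤_; _∸_; _+_; _⊔_; z≤n)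
open import Data.Nat.Properties
open import Data.Bool using (true; false)
open import Data.Bool.Properties using (¬-not; T-≡) renaming (_≟_ to _≟ᵇ_)
open import Data.Fin using (Fin)
open import Data.Fin.Subset
  using (Subset; inside; outside; _∈_; _∉_; _⊆_; _⊂_; _∩_; _∪_; _─_; ⋂; ⁅_⁆; ∣_∣; ⊤; Nonempty; Empty)
  renaming (⊥ to ∅)
open import Data.Fin.Subset.Properties
open import Data.Fin.Subset.Induction using (Acc; acc; ⊂-wellFounded)
open import Data.Fin.Properties using (any?)
open import Data.Vec using ([]; _∷_; here; there)
open import Data.Vec.Properties using (lookup∘tabulate; []=⇒lookup; lookup⇒[]=)
open import Data.List using ([]; _∷_; map; filter; foldr)
open import Data.List.Membership.Propositional using (find) renaming (_∈_ to _∈ₗ_)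
open import Data.List.Membership.Propositional.Properties
  using (∈-map⁺; ∈-map⁻; ∈-filter⁺; ∈-filter⁻; ∈-++⁺ˡ; ∈-++⁺ʳ; foldr-selective)
open import Data.List.Relation.Unary.All as All using (All)
open import Data.List.Relation.Unary.All.Properties using (¬All⇒Any¬)
import Data.List.Relation.Unary.Any as Any
open import Data.Product using (_×_; _,_; proj₁; proj₂; ∃-syntax)
open import Data.Sum using (inj₁; inj₂; [_,_]′)
open import Function using (_∘_; id)
open import Function.Bundles using (_⇔_; mk⇔; Equivalence)
open import Relation.Nullary using (yes; no; contradiction)
open import Relation.Nullary.Decidable using (toWitness; dec-true; isYes≗does; _×-dec_)
open import Relation.Binary.PropositionalEquality
  using (_≡_; refl; sym; trans; cong; subst; module ≡-Reasoning)

private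
  variable
    n : ℕ
    x : Fin n
    p q r : Subset n

Disjoint : Subset n → Subset n → Set
Disjoint p q = ∀ {x} → x ∈ p → x ∉ q

x∈p─q⇒x∉q : ∀ (p q : Subset n) → x ∈ p ─ q → x ∉ q
x∈p─q⇒x∉q (_ ∷ p) (inside  ∷ q) (there x∈p─q) (there x∈q) = x∈p─q⇒x∉q p q x∈p─q x∈q
x∈p─q⇒x∉q (_ ∷ p) (outside ∷ q) (there x∈p─q) (there x∈q) = x∈p─q⇒x∉q p q x∈p─q x∈q

─-monoˡ-⊆ : ∀ r → p ⊆ q → p ─ r ⊆ q ─ r
─-monoˡ-⊆ {p = p} r p⊆q x∈p─r = x∈p∧x∉q⇒x∈p─q (p⊆q (p─q⊆p p r x∈p─r)) (x∈p─q⇒x∉q p r x∈p─r)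

∪-lub : p ⊆ r → q ⊆ r → p ∪ q ⊆ r
∪-lub {p = p} {q = q} p⊆r q⊆r = [ p⊆r , q⊆r ]′ ∘ x∈p∪q⁻ p q

∣p∣≡∣p∩q∣+∣p─q∣ : ∀ (p q : Subset n) → ∣ p ∣ ≡ ∣ p ∩ q ∣ + ∣ p ─ q ∣
∣p∣≡∣p∩q∣+∣p─q∣ []              []              = refl
∣p∣≡∣p∩q∣+∣p─q∣ (inside  ∷ p) (inside  ∷ q) = cong suc (∣p∣≡∣p∩q∣+∣p─q∣ p q)
∣p∣≡∣p∩q∣+∣p─q∣ (inside  ∷ p) (outside ∷ q) =
  trans (cong suc (∣p∣≡∣p∩q∣+∣p─q∣ p q)) (sym (+-suc _ _))
∣p∣≡∣p∩q∣+∣p─q∣ (outside ∷ p) (inside  ∷ q) = ∣p∣≡∣p∩q∣+∣p─q∣ p q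
∣p∣≡∣p∩q∣+∣p─q∣ (outside ∷ p) (outside ∷ q) = ∣p∣≡∣p∩q∣+∣p─q∣ p q

∣p∪q∣≡∣p∣+∣q∣ : ∀ (p q : Subset n) → Disjoint p q → ∣ p ∪ q ∣ ≡ ∣ p ∣ + ∣ q ∣
∣p∪q∣≡∣p∣+∣q∣ []              []              _ = refl
∣p∪q∣≡∣p∣+∣q∣ (inside  ∷ p) (inside  ∷ q) p∩q=∅ = contradiction here (p∩q=∅ here)
∣p∪q∣≡∣p∣+∣q∣ (inside  ∷ p) (outside ∷ q) p∩q=∅ =
  cong suc (∣p∪q∣≡∣p∣+∣q∣ p q (λ x∈p → p∩q=∅ (there x∈p) ∘ there))
∣p∪q∣≡∣p∣+∣q∣ (outside ∷ p) (inside  ∷ q) p∩q=∅ =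
  trans (cong suc (∣p∪q∣≡∣p∣+∣q∣ p q (λ x∈p → p∩q=∅ (there x∈p) ∘ there))) (sym (+-suc _ _))
∣p∪q∣≡∣p∣+∣q∣ (outside ∷ p) (outside ∷ q) p∩q=∅ =
  ∣p∪q∣≡∣p∣+∣q∣ p q (λ x∈p → p∩q=∅ (there x∈p) ∘ there)

Empty⇒∣p∣≡0 : ∀ {p : Subset n} → Empty p → ∣ p ∣ ≡ 0
Empty⇒∣p∣≡0 {n} p=∅ = trans (cong ∣_∣ (Empty-unique p=∅)) (∣⊥∣≡0 n)

1≤∣p∣⇒Nonempty : 1 ≤ ∣ p ∣ → Nonempty p
1≤∣p∣⇒Nonempty {p = p} 1≤∣p∣ with nonempty? p
... | yes p≠∅ = p≠∅
... | no  p=∅ = contradiction (subst (1 ≤_) (Empty⇒∣p∣≡0 p=∅) 1≤∣p∣) λ ()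

x∈⋂⁻ : ∀ ps → x ∈ ⋂ ps → All (x ∈_) ps
x∈⋂⁻ []       _       = All.[]
x∈⋂⁻ (p ∷ ps) x∈p∩⋂ps = let x∈p , x∈⋂ps = x∈p∩q⁻ p (⋂ ps) x∈p∩⋂ps in x∈p All.∷ x∈⋂⁻ ps x∈⋂ps

x∈⋂⁺ : ∀ {ps} → All (x ∈_) ps → x ∈ ⋂ ps
x∈⋂⁺ All.[]           = ∈⊤
x∈⋂⁺ (x∈p All.∷ x∈ps) = x∈p∩q⁺ (x∈p , x∈⋂⁺ x∈ps)

∈-allSubsets : ∀ (p : Subset n) → p ∈ₗ allSubsets n
∈-allSubsets []            = Any.here refl
∈-allSubsets (inside  ∷ p) = ∈-++⁺ˡ (∈-map⁺ (inside ∷_) (∈-allSubsets p))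
∈-allSubsets {suc n} (outside ∷ p) =
  ∈-++⁺ʳ (map (inside ∷_) (allSubsets n)) (∈-map⁺ (outside ∷_) (∈-allSubsets p))

∈⇒≤foldr-⊔ : ∀ {k ks} → k ∈ₗ ks → k ≤ foldr _⊔_ 0 ks
∈⇒≤foldr-⊔ {ks = k ∷ _} (Any.here refl)  = m≤m⊔n k _
∈⇒≤foldr-⊔ {ks = k ∷ _} (Any.there k∈ks) = ≤-trans (∈⇒≤foldr-⊔ k∈ks) (m≤n⊔m k _)

module _ (G : Graph n) where

  Independent : Subset n → Set
  Independent S = ∀ u v → u ∈ S → v ∈ S → adj G u v ≡ false

  x∈N⁺ : ∀ {A u v} → u ∈ A → adj G u v ≡ true → v ∈ N G A
  x∈N⁺ {A} {u} {v} u∈A uv =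
    lookup⇒[]= v (N G A) (trans (lookup∘tabulate _ v) (dec-true (any? _) (u , u∈A , uv)))

  x∈N⁻ : ∀ {A v} → v ∈ N G A → ∃[ u ] (u ∈ A × adj G u v ≡ true)
  x∈N⁻ {A} {v} v∈NA = toWitness {a? = any? λ u → (u ∈? A) ×-dec (adj G u v ≟ᵇ true)}
    (Equivalence.from T-≡ (trans (isYes≗does _) (trans (sym (lookup∘tabulate _ v)) ([]=⇒lookup v∈NA))))

  N-mono : p ⊆ q → N G p ⊆ N G q
  N-mono p⊆q v∈Np = let u , u∈p , uv = x∈N⁻ v∈Np in x∈N⁺ (p⊆q u∈p) uv

  ∉N⇒adj≡false : ∀ {A u v} → u ∈ A → v ∉ N G A → adj G u v ≡ false
  ∉N⇒adj≡false u∈A v∉NA = ¬-not (v∉NA ∘ x∈N⁺ u∈A)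

  Independent-antimono : p ⊆ q → Independent q → Independent p
  Independent-antimono p⊆q q-ind u v u∈p v∈p = q-ind u v (p⊆q u∈p) (p⊆q v∈p)

  Independent⇒Disjoint-N : Independent p → Disjoint (N G p) p
  Independent⇒Disjoint-N p-ind v∈Np v∈p =
    let u , u∈p , uv = x∈N⁻ v∈Np in contradiction (trans (sym uv) (p-ind u _ u∈p v∈p)) λ ()

  Independent-∪ : Independent p → Independent q → Disjoint q (N G p) → Independent (p ∪ q)
  Independent-∪ {p} {q} p-ind q-ind q∩Np=∅ u v u∈p∪q v∈p∪q with x∈p∪q⁻ p q u∈p∪q | x∈p∪q⁻ p q v∈p∪q
  ... | inj₁ u∈p | inj₁ v∈p = p-ind u v u∈p v∈p
  ... | inj₁ u∈p | inj₂ v∈q = ∉N⇒adj≡false u∈p (q∩Np=∅ v∈q)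
  ... | inj₂ u∈q | inj₁ v∈p = trans (adj-sym G u v) (∉N⇒adj≡false v∈p (q∩Np=∅ u∈q))
  ... | inj₂ u∈q | inj₂ v∈q = q-ind u v u∈q v∈q

  ⁅x⁆-Independent : ∀ v → Independent ⁅ v ⁆
  ⁅x⁆-Independent v u w u∈⁅v⁆ w∈⁅v⁆
    rewrite x∈⁅y⁆⇒x≡y v u∈⁅v⁆ | x∈⁅y⁆⇒x≡y v w∈⁅v⁆ = adj-irrefl G v

  ∣S∣≤α : ∀ {W S} → Stable G W S → ∣ S ∣ ≤ α G W
  ∣S∣≤α {W} {S} S-stable =
    ∈⇒≤foldr-⊔ (∈-map⁺ ∣_∣ (∈-filter⁺ (stable? G W) (∈-allSubsets S) S-stable))

  MaxStable-exists : ∀ W → ∃[ S ] MaxStable G W S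
  MaxStable-exists W with foldr-selective ⊔-sel 0 (map ∣_∣ (filter (stable? G W) (allSubsets n)))
  ... | inj₁ α≡0 = ∅ , (⊥⊆ , λ _ _ u∈∅ → contradiction u∈∅ ∉⊥) , trans (∣⊥∣≡0 n) (sym α≡0)
  ... | inj₂ α∈sizes with ∈-map⁻ ∣_∣ α∈sizes
  ...   | S , S∈stables , α≡∣S∣ = S , proj₂ (∈-filter⁻ (stable? G W) {xs = allSubsets n} S∈stables) , sym α≡∣S∣

  ∈Ω : ∀ {W S} → MaxStable G W S → S ∈ₗ Ω G W
  ∈Ω {W} {S} = ∈-filter⁺ (maxStable? G W) (∈-allSubsets S)

  core⊆MaxStable : ∀ {W S} → MaxStable G W S → core G W ⊆ S
  core⊆MaxStable {W} S-max x∈core = All.lookup (x∈⋂⁻ (Ω G W) x∈core) (∈Ω S-max)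

  ∉core⇒∃MaxStable∌ : ∀ {W v} → v ∉ core G W → ∃[ S ] (MaxStable G W S × v ∉ S)
  ∉core⇒∃MaxStable∌ {W} {v} v∉core =
    let S , S∈Ω , v∉S = find (¬All⇒Any¬ (v ∈?_) (Ω G W) (v∉core ∘ x∈⋂⁺))
    in S , proj₂ (∈-filter⁻ (maxStable? G W) {xs = allSubsets n} S∈Ω) , v∉S

  core⊆W : ∀ W → core G W ⊆ W
  core⊆W W = let _ , S-max = MaxStable-exists W in proj₁ (proj₁ S-max) ∘ core⊆MaxStable {W} S-max

  core-Independent : ∀ W → Independent (core G W)
  core-Independent W = let _ , S-max = MaxStable-exists W in
    Independent-antimono (core⊆MaxStable S-max) (proj₂ (proj₁ S-max))

  Independent⇒Stable : ∀ {S} → Independent S → Stable G ⊤ S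
  Independent⇒Stable S-ind = (λ _ → ∈⊤) , S-ind

  MaxStable-exchange : ∀ {U D} → MaxStable G ⊤ U → Independent D → Disjoint D U →
                       ∣ D ∣ ≤ ∣ U ∩ N G D ∣
  MaxStable-exchange {U} {D} ((_ , U-ind) , ∣U∣≡α) D-ind D∩U=∅ =
    +-cancelʳ-≤ ∣ U ─ N G D ∣ _ _ (begin
      ∣ D ∣ + ∣ U ─ N G D ∣          ≡⟨ ∣p∪q∣≡∣p∣+∣q∣ D (U ─ N G D) D∩U─ND=∅ ⟨
      ∣ D ∪ (U ─ N G D) ∣            ≤⟨ ∣S∣≤α (Independent⇒Stable swapped) ⟩
      α G ⊤                           ≡⟨ ∣U∣≡α ⟨
      ∣ U ∣                           ≡⟨ ∣p∣≡∣p∩q∣+∣p─q∣ U (N G D) ⟩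
      ∣ U ∩ N G D ∣ + ∣ U ─ N G D ∣  ∎)
    where
    open ≤-Reasoning
    D∩U─ND=∅ : Disjoint D (U ─ N G D)
    D∩U─ND=∅ x∈D = D∩U=∅ x∈D ∘ p─q⊆p U (N G D)
    swapped : Independent (D ∪ (U ─ N G D))
    swapped = Independent-∪ D-ind (Independent-antimono (p─q⊆p U (N G D)) U-ind) (x∈p─q⇒x∉q U (N G D))

  MaxStable-dominating : ∀ {U v} → MaxStable G ⊤ U → v ∉ U → ∃[ u ] (u ∈ U × adj G v u ≡ true)
  MaxStable-dominating {U} {v} U-max v∉U =
    let u , u∈U∩N⁅v⁆ = 1≤∣p∣⇒Nonempty (subst (_≤ ∣ U ∩ N G ⁅ v ⁆ ∣) (∣⁅x⁆∣≡1 v)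
                         (MaxStable-exchange U-max (⁅x⁆-Independent v) ⁅v⁆∩U=∅))
        u∈U , u∈N⁅v⁆ = x∈p∩q⁻ U _ u∈U∩N⁅v⁆
        w , w∈⁅v⁆ , wu = x∈N⁻ u∈N⁅v⁆
    in u , u∈U , subst (λ w → adj G w u ≡ true) (x∈⁅y⁆⇒x≡y v w∈⁅v⁆) wu
    where
    ⁅v⁆∩U=∅ : Disjoint ⁅ v ⁆ U
    ⁅v⁆∩U=∅ w∈⁅v⁆ = subst (_∉ U) (sym (x∈⁅y⁆⇒x≡y v w∈⁅v⁆)) v∉U

  MaxStable-Disjoint-N-core : ∀ {S} → MaxStable G ⊤ S → Disjoint S (N G (core G ⊤))
  MaxStable-Disjoint-N-core S-max x∈S x∈Ncore =
    Independent⇒Disjoint-N (proj₂ (proj₁ S-max)) (N-mono (core⊆MaxStable S-max) x∈Ncore) x∈S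

  ∣A∣≤∣NA─Ncore∣-step : ∀ {A U} → MaxStable G ⊤ U → Independent A →
                        ∣ A ∩ U ∣ ≤ ∣ N G (A ∩ U) ─ N G (core G ⊤) ∣ →
                        ∣ A ∣ ≤ ∣ N G A ─ N G (core G ⊤) ∣
  ∣A∣≤∣NA─Ncore∣-step {A} {U} U-max A-ind A∩U-bound = begin
    ∣ A ∣                              ≡⟨ ∣p∣≡∣p∩q∣+∣p─q∣ A U ⟩
    ∣ A ∩ U ∣ + ∣ A ─ U ∣              ≤⟨ +-mono-≤ A∩U-bound A─U-bound ⟩
    ∣ N G (A ∩ U) ─ Ncore ∣ + ∣ U ∩ N G (A ─ U) ∣
                                       ≡⟨ ∣p∪q∣≡∣p∣+∣q∣ _ _ disjoint ⟨
    ∣ (N G (A ∩ U) ─ Ncore) ∪ (U ∩ N G (A ─ U)) ∣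
                                       ≤⟨ p⊆q⇒∣p∣≤∣q∣ (∪-lub included-left included-right) ⟩
    ∣ N G A ─ Ncore ∣                  ∎
    where
    open ≤-Reasoning
    Ncore : Subset n
    Ncore = N G (core G ⊤)
    A─U-bound : ∣ A ─ U ∣ ≤ ∣ U ∩ N G (A ─ U) ∣
    A─U-bound = MaxStable-exchange U-max (Independent-antimono (p─q⊆p A U) A-ind) (x∈p─q⇒x∉q A U)
    disjoint : Disjoint (N G (A ∩ U) ─ Ncore) (U ∩ N G (A ─ U))
    disjoint x∈N[A∩U]─Ncore x∈U∩N[A─U] =
      Independent⇒Disjoint-N (proj₂ (proj₁ U-max))
        (N-mono (p∩q⊆q A U) (p─q⊆p _ Ncore x∈N[A∩U]─Ncore)) (p∩q⊆p U _ x∈U∩N[A─U])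
    included-left : N G (A ∩ U) ─ Ncore ⊆ N G A ─ Ncore
    included-left = ─-monoˡ-⊆ Ncore (N-mono (p∩q⊆p A U))
    included-right : U ∩ N G (A ─ U) ⊆ N G A ─ Ncore
    included-right x∈U∩N[A─U] = let x∈U , x∈N[A─U] = x∈p∩q⁻ U _ x∈U∩N[A─U] in
      x∈p∧x∉q⇒x∈p─q (N-mono (p─q⊆p A U) x∈N[A─U]) (MaxStable-Disjoint-N-core U-max x∈U)

  ∣A∣≤∣NA─Ncore∣ : ∀ {A} → Acc _⊂_ A → Independent A → Disjoint A (core G ⊤) →
                   ∣ A ∣ ≤ ∣ N G A ─ N G (core G ⊤) ∣
  ∣A∣≤∣NA─Ncore∣ {A} (acc smaller) A-ind A∩core=∅ with nonempty? A
  ... | no  A=∅ = subst (_≤ ∣ N G A ─ N G (core G ⊤) ∣) (sym (Empty⇒∣p∣≡0 A=∅)) z≤n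
  ... | yes (a , a∈A) with ∉core⇒∃MaxStable∌ (A∩core=∅ a∈A)
  ...   | U , U-max , a∉U = ∣A∣≤∣NA─Ncore∣-step U-max A-ind
    (∣A∣≤∣NA─Ncore∣ (smaller (p∩q⊆p A U , a , a∈A , a∉U ∘ p∩q⊆q A U))
       (Independent-antimono (p∩q⊆p A U) A-ind) (A∩core=∅ ∘ p∩q⊆p A U))

  H : Subset n
  H = ⊤ ─ N[ G ] (core G ⊤)

  x∈H⁻ : ∀ {v} → v ∈ H → v ∉ core G ⊤ × v ∉ N G (core G ⊤)
  x∈H⁻ v∈H = let v∉N[core] = x∈p─q⇒x∉q ⊤ (N[ G ] (core G ⊤)) v∈H in
    v∉N[core] ∘ x∈p∪q⁺ ∘ inj₁ , v∉N[core] ∘ x∈p∪q⁺ ∘ inj₂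

  x∈H⁺ : ∀ {v} → v ∉ core G ⊤ → v ∉ N G (core G ⊤) → v ∈ H
  x∈H⁺ v∉core v∉Ncore =
    x∈p∧x∉q⇒x∈p─q ∈⊤ λ v∈N[core] → [ v∉core , v∉Ncore ]′ (x∈p∪q⁻ _ _ v∈N[core])

  MaxStable─H≡core : ∀ {S} → MaxStable G ⊤ S → S ─ H ≡ core G ⊤
  MaxStable─H≡core {S} S-max = ⊆-antisym ⊆core core⊆
    where
    ⊆core : S ─ H ⊆ core G ⊤
    ⊆core {x} x∈S─H with x ∈? core G ⊤
    ... | yes x∈core = x∈core
    ... | no  x∉core = contradiction
      (x∈H⁺ x∉core (MaxStable-Disjoint-N-core S-max (p─q⊆p S H x∈S─H))) (x∈p─q⇒x∉q S H x∈S─H)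
    core⊆ : core G ⊤ ⊆ S ─ H
    core⊆ x∈core = x∈p∧x∉q⇒x∈p─q (core⊆MaxStable S-max x∈core) (λ x∈H → proj₁ (x∈H⁻ x∈H) x∈core)

  ∣S∣≡ξ+∣S∩H∣ : ∀ {S} → MaxStable G ⊤ S → ∣ S ∣ ≡ ξ G ⊤ + ∣ S ∩ H ∣
  ∣S∣≡ξ+∣S∩H∣ {S} S-max = begin
    ∣ S ∣                  ≡⟨ ∣p∣≡∣p∩q∣+∣p─q∣ S H ⟩
    ∣ S ∩ H ∣ + ∣ S ─ H ∣  ≡⟨ cong (λ X → ∣ S ∩ H ∣ + ∣ X ∣) (MaxStable─H≡core S-max) ⟩
    ∣ S ∩ H ∣ + ξ G ⊤      ≡⟨ +-comm ∣ S ∩ H ∣ (ξ G ⊤) ⟩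
    ξ G ⊤ + ∣ S ∩ H ∣      ∎
    where open ≡-Reasoning

  ∩H-Stable : ∀ {S} → Stable G ⊤ S → Stable G H (S ∩ H)
  ∩H-Stable {S} (_ , S-ind) = p∩q⊆q S H , Independent-antimono (p∩q⊆p S H) S-ind

  core∪-Stable : ∀ {T} → Stable G H T → Stable G ⊤ (core G ⊤ ∪ T)
  core∪-Stable (T⊆H , T-ind) =
    Independent⇒Stable (Independent-∪ (core-Independent ⊤) T-ind (proj₂ ∘ x∈H⁻ ∘ T⊆H))

  ∣core∪T∣≡ξ+∣T∣ : ∀ {T} → Stable G H T → ∣ core G ⊤ ∪ T ∣ ≡ ξ G ⊤ + ∣ T ∣
  ∣core∪T∣≡ξ+∣T∣ {T} (T⊆H , _) =
    ∣p∪q∣≡∣p∣+∣q∣ (core G ⊤) T λ x∈core x∈T → proj₁ (x∈H⁻ (T⊆H x∈T)) x∈core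

  [core∪T]∩H≡T : ∀ {T} → Stable G H T → (core G ⊤ ∪ T) ∩ H ≡ T
  [core∪T]∩H≡T {T} (T⊆H , _) = ⊆-antisym ⊆T T⊆
    where
    ⊆T : (core G ⊤ ∪ T) ∩ H ⊆ T
    ⊆T x∈[core∪T]∩H with x∈p∩q⁻ (core G ⊤ ∪ T) H x∈[core∪T]∩H
    ... | x∈core∪T , x∈H =
      [ (λ x∈core → contradiction x∈core (proj₁ (x∈H⁻ x∈H))) , id ]′ (x∈p∪q⁻ (core G ⊤) T x∈core∪T)
    T⊆ : T ⊆ (core G ⊤ ∪ T) ∩ H
    T⊆ x∈T = x∈p∩q⁺ (q⊆p∪q (core G ⊤) T x∈T , T⊆H x∈T)

  ξ+α[H]≡α : ξ G ⊤ + α G H ≡ α G ⊤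
  ξ+α[H]≡α = ≤-antisym ≤α α≤
    where
    open ≤-Reasoning
    ≤α : ξ G ⊤ + α G H ≤ α G ⊤
    ≤α = let T , T-stable , ∣T∣≡α[H] = MaxStable-exists H in begin
      ξ G ⊤ + α G H          ≡⟨ cong (ξ G ⊤ +_) ∣T∣≡α[H] ⟨
      ξ G ⊤ + ∣ T ∣          ≡⟨ ∣core∪T∣≡ξ+∣T∣ T-stable ⟨
      ∣ core G ⊤ ∪ T ∣       ≤⟨ ∣S∣≤α (core∪-Stable T-stable) ⟩
      α G ⊤                  ∎
    α≤ : α G ⊤ ≤ ξ G ⊤ + α G H
    α≤ = let S , S-max = MaxStable-exists ⊤ in begin
      α G ⊤                  ≡⟨ proj₂ S-max ⟨
      ∣ S ∣                  ≡⟨ ∣S∣≡ξ+∣S∩H∣ S-max ⟩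
      ξ G ⊤ + ∣ S ∩ H ∣      ≤⟨ +-monoʳ-≤ (ξ G ⊤) (∣S∣≤α (∩H-Stable (proj₁ S-max))) ⟩
      ξ G ⊤ + α G H          ∎

  ∩H-MaxStable : ∀ {S} → MaxStable G ⊤ S → MaxStable G H (S ∩ H)
  ∩H-MaxStable {S} S-max = ∩H-Stable (proj₁ S-max) , +-cancelˡ-≡ (ξ G ⊤) _ _ (begin
    ξ G ⊤ + ∣ S ∩ H ∣  ≡⟨ ∣S∣≡ξ+∣S∩H∣ S-max ⟨
    ∣ S ∣              ≡⟨ proj₂ S-max ⟩
    α G ⊤              ≡⟨ ξ+α[H]≡α ⟨
    ξ G ⊤ + α G H      ∎)
    where open ≡-Reasoning

  core∪-MaxStable : ∀ {T} → MaxStable G H T → MaxStable G ⊤ (core G ⊤ ∪ T)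
  core∪-MaxStable {T} (T-stable , ∣T∣≡α[H]) = core∪-Stable T-stable , (begin
    ∣ core G ⊤ ∪ T ∣  ≡⟨ ∣core∪T∣≡ξ+∣T∣ T-stable ⟩
    ξ G ⊤ + ∣ T ∣     ≡⟨ cong (ξ G ⊤ +_) ∣T∣≡α[H] ⟩
    ξ G ⊤ + α G H     ≡⟨ ξ+α[H]≡α ⟩
    α G ⊤             ∎)
    where open ≡-Reasoning

  core[H]-Empty : Empty (core G H)
  core[H]-Empty (v , v∈core[H]) =
    let S , S-max , v∉S = ∉core⇒∃MaxStable∌ (proj₁ (x∈H⁻ (core⊆W H v∈core[H])))
    in v∉S (p∩q⊆p S H (core⊆MaxStable {H} (∩H-MaxStable S-max) v∈core[H]))

  α[H]≡α∸ξ : α G H ≡ α G ⊤ ∸ ξ G ⊤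
  α[H]≡α∸ξ = trans (sym (m+n∸m≡n (ξ G ⊤) (α G H))) (cong (_∸ ξ G ⊤) ξ+α[H]≡α)

  MaxStable[H]⇔ : ∀ T → MaxStable G H T ⇔ (∃[ S ] (MaxStable G ⊤ S × T ≡ S ∩ H))
  MaxStable[H]⇔ T = mk⇔ extend restrict
    where
    extend : MaxStable G H T → ∃[ S ] (MaxStable G ⊤ S × T ≡ S ∩ H)
    extend T-max = core G ⊤ ∪ T , core∪-MaxStable T-max , sym ([core∪T]∩H≡T (proj₁ T-max))
    restrict : ∃[ S ] (MaxStable G ⊤ S × T ≡ S ∩ H) → MaxStable G H T
    restrict (S , S-max , refl) = ∩H-MaxStable S-max

  H-no-isolated : ∀ v → v ∈ H → ∃[ u ] (u ∈ H × adj G v u ≡ true)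
  H-no-isolated v v∈H =
    let v∉core , v∉Ncore = x∈H⁻ v∈H
        S , S-max , v∉S = ∉core⇒∃MaxStable∌ v∉core
        u , u∈S , vu = MaxStable-dominating S-max v∉S
        u∉core = λ u∈core → v∉Ncore (x∈N⁺ u∈core (trans (adj-sym G u v) vu))
    in u , x∈H⁺ u∉core (MaxStable-Disjoint-N-core S-max u∈S) , vu

  ∣S─core∣≤∣NS─Ncore∣ : ∀ S → MaxStable G ⊤ S → ∣ S ─ core G ⊤ ∣ ≤ ∣ N G S ─ N G (core G ⊤) ∣
  ∣S─core∣≤∣NS─Ncore∣ S ((_ , S-ind) , _) = ≤-trans
    (∣A∣≤∣NA─Ncore∣ (⊂-wellFounded (S ─ core G ⊤))
      (Independent-antimono (p─q⊆p S (core G ⊤)) S-ind) (x∈p─q⇒x∉q S (core G ⊤)))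
    (p⊆q⇒∣p∣≤∣q∣ (─-monoˡ-⊆ (N G (core G ⊤)) (N-mono (p─q⊆p S (core G ⊤)))))

proposition3 : ∀ {n} (G : Graph n) →
    let H = ⊤ ─ N[ G ] (core G ⊤) in
    (∀ v → v ∈ H → ∃[ u ] (u ∈ H × adj G v u ≡ true))
    × (α G H ≡ α G ⊤ ∸ ξ G ⊤)
    × (∀ SH → MaxStable G H SH ⇔ (∃[ SG ] (MaxStable G ⊤ SG × SH ≡ SG ∩ H)))
    × (ξ G H ≡ 0)
    × (∀ S → MaxStable G ⊤ S → ∣ S ─ core G ⊤ ∣ ≤ ∣ N G S ─ N G (core G ⊤) ∣)
proposition3 G =
    H-no-isolated G
  , α[H]≡α∸ξ G
  , MaxStable[H]⇔ G
  , Empty⇒∣p∣≡0 (core[H]-Empty G)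
  , ∣S─core∣≤∣NS─Ncore∣ G
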